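{- Let $\mathcal{G}$ be a monotone graph class containing $K_2$. Then for every graph $H$, $c^{\mathcal{G}}_{\mathrm u}(H)\le \lceil\log\chi(H)\rceil\cdot\bigl(c^{\mathcal{G}}_{\mathrm f}(H)\bigr)^2$.
   Context: All graphs are finite and simple; $\chi$ denotes chromatic number and $\log$ the binary logarithm. A class is monotone if closed under taking subgraphs. For graphs $G,H$, a homomorphism $\varphi\colon G\to H$ is a map $V(G)\to V(H)$ with $\varphi(u)\varphi(v)\in E(H)$ whenever $uv\in E(G)$. $\dot\cup$ denotes vertex-disjoint union. For a graph class $\mathcal{G}$ and a graph $H$, a $\mathcal{G}$-cover of $H$ is an edge-surjective homomorphism $\varphi\colon G_1\dot\cup\cdots\dot\cup G_t\to H$ with all $G_i\in\mathcal{G}$; it is called $t$-global, injective if each $\varphi|_{G_i}$ is injective, and $s$-local if $|\varphi^{ -1}(v)|\le s$ for all $v\in V(H)$. $\overline{\mathcal{G}}$ is the class of all vertex-disjoint unions of graphs in $\mathcal{G}$. $c^{\mathcal{G}}_{\mathrm u}(H)$ is the least $t\ge0$ such that $H$ has a $t$-global injective $\overline{\mathcal{G}}$-cover; $c^{\mathcal{G}}_{\mathrm f}(H)$ the least $s$ such that $H$ has an $s$-local (not necessarily injective) $\mathcal{G}$-cover. -}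

module Defs where

open import Data.Nat using (ℕ; _≤_; _*_)
open import Data.Nat.Logarithm using (⌈log₂_⌉)
open import Data.Fin using (Fin)
open import Data.Fin.Properties using (_≟_)
open import Data.Product using (Σ; ∃; _×_; _,_)
open import Data.List using (List; length; filter; map)
open import Data.Nat.ListAction using (sum)
open import Data.List using (allFin)
open import Relation.Binary.PropositionalEquality using (_≡_; _≢_; sym)
open import Relation.Nullary using (¬_)
open import Function.Definitions using (Injective)
open import Function.Bundles using (_↔_)
open import Level using (Lift; suc; zero)

record Graph : Set₁ where
  field
    n      : ℕ
    Adj    : Fin n → Fin n → Set
    adj-sym : ∀ {u v} → Adj u v → Adj v u
    irrefl : ∀ {u} → ¬ Adj u u
open Graph public

V : Graph → Set
V G = Fin (n G)

GraphClass : Set₂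
GraphClass = Graph → Set₁

IsHom : (G H : Graph) → (V G → V H) → Set
IsHom G H φ = ∀ {u v} → Adj G u v → Adj H (φ u) (φ v)

Subgraph : Graph → Graph → Set
Subgraph G' G = Σ (V G' → V G) λ f → Injective _≡_ _≡_ f × IsHom G' G f

Monotone : GraphClass → Set₁
Monotone 𝒢 = ∀ (G G' : Graph) → Subgraph G' G → 𝒢 G → 𝒢 G'

K₂ : Graph
K₂ = record { n = 2 ; Adj = λ x y → x ≢ y ; adj-sym = λ p q → p (sym q) ; irrefl = λ p → p _≡_.refl }

-- Closure under vertex-disjoint unions: K is isomorphic to the disjoint union
-- of a finite family F₁,…,F_k of graphs in 𝒢 (vertex set Σ j. V(F j), edges
-- only inside one F j).
Bar : GraphClass → GraphClass
Bar 𝒢 K = Σ ℕ λ k → Σ (Fin k → Graph) λ F →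
  ((j : Fin k) → 𝒢 (F j)) ×
  Σ (V K ↔ Σ (Fin k) (λ j → V (F j))) λ iso →
    ∀ (u v : V K) →
      (Adj K u v → DUAdj F (Function.Bundles.Inverse.to iso u) (Function.Bundles.Inverse.to iso v)) ×
      (DUAdj F (Function.Bundles.Inverse.to iso u) (Function.Bundles.Inverse.to iso v) → Adj K u v)
  where
  DUAdj : ∀ {k} (F : Fin k → Graph) → Σ (Fin k) (λ j → V (F j)) → Σ (Fin k) (λ j → V (F j)) → Set
  DUAdj F (i , x) (j , y) = Σ (i ≡ j) λ { _≡_.refl → Adj (F i) x y }

-- A t-global 𝒢-cover of H: graphs G₁,…,G_t in 𝒢 and homomorphisms φ_i : G_i → H
-- (i.e. a homomorphism from their disjoint union) which is edge-surjective.
record Cover (𝒢 : GraphClass) (H : Graph) (t : ℕ) : Set₁ where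
  field
    G     : Fin t → Graph
    inCls : (i : Fin t) → 𝒢 (G i)
    φ     : (i : Fin t) → V (G i) → V H
    hom   : (i : Fin t) → IsHom (G i) H (φ i)
    surj  : ∀ {u v} → Adj H u v →
            Σ (Fin t) λ i → Σ (V (G i)) λ x → Σ (V (G i)) λ y →
              Adj (G i) x y × φ i x ≡ u × φ i y ≡ v
open Cover public

Injective-Cover : ∀ {𝒢 H t} → Cover 𝒢 H t → Set
Injective-Cover C = ∀ i → Injective _≡_ _≡_ (φ C i)

preimageSize : ∀ {𝒢 H t} → Cover 𝒢 H t → V H → ℕ
preimageSize {t = t} C v =
  sum (map (λ i → length (filter (λ x → φ C i x ≟ v) (allFin (n (G C i))))) (allFin t))

Local : ∀ {𝒢 H t} → ℕ → Cover 𝒢 H t → Set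
Local s C = ∀ v → preimageSize C v ≤ s

HasUCover : GraphClass → Graph → ℕ → Set₁
HasUCover 𝒢 H t = Σ (Cover (Bar 𝒢) H t) Injective-Cover

HasFCover : GraphClass → Graph → ℕ → Set₁
HasFCover 𝒢 H s = Σ ℕ λ t → Σ (Cover 𝒢 H t) (Local s)

IsLeast : (ℕ → Set₁) → ℕ → Set₁
IsLeast P m = P m × (∀ m' → P m' → m ≤ m')

IsCu : GraphClass → Graph → ℕ → Set₁
IsCu 𝒢 H = IsLeast (HasUCover 𝒢 H)

IsCf : GraphClass → Graph → ℕ → Set₁
IsCf 𝒢 H = IsLeast (HasFCover 𝒢 H)

Colorable : Graph → ℕ → Set
Colorable H k = Σ (V H → Fin k) λ c → ∀ {u v} → Adj H u v → c u ≢ c v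

IsChi : Graph → ℕ → Set₁
IsChi H = IsLeast (λ k → Lift (suc zero) (Colorable H k))

{-# OPTIONS --safe #-}
module Submission where

-- Fix an s-local 𝒢-cover of H and a proper colouring of H whose colours are the words of length L
-- over an alphabet of size b (b = 2 and L = ⌈log₂ χ⌉ for the theorem). Numbering the preimages of
-- each vertex of H gives every vertex of the cover a label in [s], injective on each fibre. For a
-- position i < L and a map ℓ from letters to labels, keep the cover vertices whose label is ℓ of the
-- i-th letter of the colour of their image. Two kept vertices with the same image have the same
-- colour, hence the same label, hence coincide; so the kept part is an injective cover by a disjoint
-- union of induced subgraphs of members of 𝒢. An edge uv of H lifts to an edge xy of the cover, the
-- colours of u and v differ at some position i, and a map ℓ sending these two letters to the labels
-- of x and y keeps both endpoints. Hence the L · s^b choices of (i, ℓ) give an injective cover.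

open import Defs
open import Data.Nat using (ℕ; zero; suc; _+_; _*_; _^_; _≤_; _<_; z≤n; ⌊_/2⌋; ⌈_/2⌉)
open import Data.Nat.Properties
  using (+-identityʳ; ≤-refl; ≤-trans; <-≤-trans; +-monoˡ-≤; *-monoʳ-≤;
         ⌊n/2⌋≤⌈n/2⌉; ⌊n/2⌋+⌈n/2⌉≡n; ⌈n/2⌉<n; module ≤-Reasoning)
open import Data.Nat.Induction using (<-wellFounded)
open import Data.Nat.Logarithm using (⌈log₂_⌉)
open import Data.Nat.Logarithm.Core using (⌈log2⌉)
open import Data.Nat.ListAction using (sum)
open import Induction.WellFounded using (Acc; acc)
open import Data.Bool using (true; false)
open import Data.Empty using (⊥)
open import Data.Fin using (Fin; zero; suc; toℕ; fromℕ<; inject≤; combine; remQuot; finToFun; funToFin)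
open import Data.Fin.Properties
  using (_≟_; +↔⊎; toℕ<n; toℕ-injective; fromℕ<-injective; inject≤-injective; remQuot-combine;
         funToFin-finToFin; finToFun-funToFin; ¬∀⟶∃¬)
open import Data.List using (List; []; _∷_; _++_; length; map; filter; concatMap; allFin; lookup)
open import Data.List.Properties using (length-++; filter-++; map-cong)
import Data.List.Relation.Unary.All as All
import Data.List.Relation.Unary.Any as Any
open import Data.List.Relation.Unary.Any.Properties using (lookup-index)
open import Data.List.Relation.Unary.AllPairs using (_∷_)
open import Data.List.Relation.Unary.Unique.Propositional using (Unique)
open import Data.List.Relation.Unary.Unique.Propositional.Properties using (allFin⁺; filter⁺)
open import Data.List.Membership.Propositional using (_∈_)
open import Data.List.Membership.Propositional.Properties
  using (∈-allFin; ∈-filter⁺; ∈-filter⁻; ∈-lookup; ∈-map⁺; ∈-concatMap⁺)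
open import Data.List.Membership.Setoid.Properties using (index-injective)
open import Data.Product using (Σ; ∃; _×_; _,_; proj₂; uncurry; map₂)
open import Data.Product.Properties using (Σ-≡,≡←≡)
open import Data.Sum using (_⊎_; inj₁; inj₂)
open import Data.Sum.Function.Propositional using (_⊎-↔_)
open import Data.Vec.Functional using (foldr; updateAt)
open import Data.Vec.Functional.Properties using (updateAt-updates; updateAt-minimal)
open import Function using (_∘_; id; const)
open import Function.Bundles using (_↔_; Inverse; mk↔ₛ′; Injection)
open import Function.Definitions using (Injective)
open import Function.Properties.Inverse using (↔-refl; ↔-sym; ↔-trans; ↔⇒↣)
open import Level using (Level; lift)
open import Relation.Binary.Definitions using (DecidableEquality)
open import Relation.Binary.PropositionalEquality
  using (_≡_; _≢_; refl; sym; trans; cong; cong₂; subst; subst₂; setoid; module ≡-Reasoning)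
open import Relation.Nullary using (does; contradiction)
open import Relation.Unary using (Pred; Decidable)

n≤2*⌈n/2⌉ : ∀ n → n ≤ 2 * ⌈ n /2⌉
n≤2*⌈n/2⌉ n = begin
  n                  ≡⟨ ⌊n/2⌋+⌈n/2⌉≡n n ⟨
  ⌊ n /2⌋ + ⌈ n /2⌉  ≤⟨ +-monoˡ-≤ ⌈ n /2⌉ (⌊n/2⌋≤⌈n/2⌉ n) ⟩
  ⌈ n /2⌉ + ⌈ n /2⌉  ≡⟨ cong (⌈ n /2⌉ +_) (+-identityʳ ⌈ n /2⌉) ⟨
  2 * ⌈ n /2⌉        ∎
  where open ≤-Reasoning

n≤2^⌈log2⌉n : ∀ n (rec : Acc _<_ n) → n ≤ 2 ^ ⌈log2⌉ n rec
n≤2^⌈log2⌉n zero          _        = z≤n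
n≤2^⌈log2⌉n (suc zero)    _        = ≤-refl
n≤2^⌈log2⌉n (suc (suc n)) (acc rs) =
  ≤-trans (n≤2*⌈n/2⌉ (2 + n)) (*-monoʳ-≤ 2 (n≤2^⌈log2⌉n (suc ⌈ n /2⌉) (rs (⌈n/2⌉<n n))))

n≤2^⌈log₂n⌉ : ∀ n → n ≤ 2 ^ ⌈log₂ n ⌉
n≤2^⌈log₂n⌉ n = n≤2^⌈log2⌉n n (<-wellFounded n)

funToFin-cong : ∀ {m n} {f g : Fin m → Fin n} → (∀ i → f i ≡ g i) → funToFin f ≡ funToFin g
funToFin-cong {zero}  f≗g = refl
funToFin-cong {suc m} f≗g = cong₂ combine (f≗g zero) (funToFin-cong (f≗g ∘ suc))

finToFun-separates : ∀ {m n} {a a' : Fin (m ^ n)} → a ≢ a' → ∃ λ i → finToFun a i ≢ finToFun a' i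
finToFun-separates {m} {n} {a} {a'} a≢a' =
  ¬∀⟶∃¬ n _ (λ i → finToFun a i ≟ finToFun a' i) λ same → a≢a' (begin
    a                               ≡⟨ funToFin-finToFin {n} {m} a ⟨
    funToFin (finToFun {m} {n} a)   ≡⟨ funToFin-cong same ⟩
    funToFin (finToFun {m} {n} a')  ≡⟨ funToFin-finToFin {n} {m} a' ⟩
    a'                              ∎)
  where open ≡-Reasoning

lookup-injective : ∀ {A : Set} {xs : List A} → Unique xs → Injective _≡_ _≡_ (lookup xs)
lookup-injective (_ ∷ _)      {zero}  {zero}  _  = refl
lookup-injective (x∉xs ∷ _)   {zero}  {suc j} eq = contradiction eq (All.lookup x∉xs (∈-lookup j))
lookup-injective (x∉xs ∷ _)   {suc i} {zero}  eq = contradiction (sym eq) (All.lookup x∉xs (∈-lookup i))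
lookup-injective (_ ∷ unique) {suc i} {suc j} eq = cong suc (lookup-injective unique eq)

map₂-injective : ∀ {I : Set} {A B : I → Set} {g : ∀ {i} → A i → B i} →
  (∀ {i} → Injective _≡_ _≡_ (g {i})) → Injective _≡_ _≡_ (map₂ {B = A} g)
map₂-injective g-injective {i , a} {j , a'} eq with refl , ga≡ga' ← Σ-≡,≡←≡ eq =
  cong (i ,_) (g-injective ga≡ga')

module _ {A : Set} {p : Level} {P : Pred A p} (P? : Decidable P) where

  length-filter-map : ∀ {B : Set} (f : B → A) xs →
    length (filter P? (map f xs)) ≡ length (filter (P? ∘ f) xs)
  length-filter-map f []       = refl
  length-filter-map f (x ∷ xs) with does (P? (f x))
  ... | true  = cong suc (length-filter-map f xs)
  ... | false = length-filter-map f xs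

  length-filter-concatMap : ∀ {B : Set} (g : B → List A) xs →
    length (filter P? (concatMap g xs)) ≡ sum (map (length ∘ filter P? ∘ g) xs)
  length-filter-concatMap g []       = refl
  length-filter-concatMap g (x ∷ xs) = begin
    length (filter P? (g x ++ concatMap g xs))                       ≡⟨ cong length (filter-++ P? (g x) _) ⟩
    length (filter P? (g x) ++ filter P? (concatMap g xs))           ≡⟨ length-++ (filter P? (g x)) ⟩
    length (filter P? (g x)) + length (filter P? (concatMap g xs))   ≡⟨ cong (_ +_) (length-filter-concatMap g xs) ⟩
    length (filter P? (g x)) + sum (map (length ∘ filter P? ∘ g) xs) ∎
    where open ≡-Reasoning

module Fibres {A B : Set} (_≟ᴮ_ : DecidableEquality B) (f : A → B)
              {xs : List A} (complete : ∀ a → a ∈ xs) where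

  fibre : B → List A
  fibre b = filter (λ a → f a ≟ᴮ b) xs

  ∈-fibre : ∀ a → a ∈ fibre (f a)
  ∈-fibre a = ∈-filter⁺ (λ a' → f a' ≟ᴮ f a) (complete a) refl

  rank : A → ℕ
  rank a = toℕ (Any.index (∈-fibre a))

  rank<∣fibre∣ : ∀ a → rank a < length (fibre (f a))
  rank<∣fibre∣ a = toℕ<n (Any.index (∈-fibre a))

  rank-injective : ∀ {a a'} → f a ≡ f a' → rank a ≡ rank a' → a ≡ a'
  rank-injective {a} {a'} fa≡fa' = positions-injective fa≡fa' (∈-fibre a) (∈-fibre a')
    where
    positions-injective : ∀ {b b'} → b ≡ b' → (p : a ∈ fibre b) (p' : a' ∈ fibre b') →
      toℕ (Any.index p) ≡ toℕ (Any.index p') → a ≡ a'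
    positions-injective refl p p' = index-injective (setoid A) p p' ∘ toℕ-injective

Colorable-≤ : ∀ {H k k'} → k ≤ k' → Colorable H k → Colorable H k'
Colorable-≤ k≤k' (c , proper) =
  (λ u → inject≤ (c u) k≤k') , λ uv → proper uv ∘ inject≤-injective k≤k' k≤k' _ _

Lifts : (K H : Graph) → (V K → V H) → V H → V H → Set
Lifts K H ψ u v = Σ (V K) λ x → Σ (V K) λ y → Adj K x y × ψ x ≡ u × ψ y ≡ v

module Induced (G : Graph) {P : Pred (V G) Level.zero} (P? : Decidable P) where

  private
    members : List (V G)
    members = filter P? (allFin (n G))

  induced : Graph
  induced = record
    { n = length members ; Adj = λ a b → Adj G (lookup members a) (lookup members b)
    ; adj-sym = adj-sym G ; irrefl = irrefl G }

  embed : V induced → V G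
  embed = lookup members

  embed-injective : Injective _≡_ _≡_ embed
  embed-injective = lookup-injective (filter⁺ P? (allFin⁺ (n G)))

  embed-∈ : ∀ a → P (embed a)
  embed-∈ a = proj₂ (∈-filter⁻ P? {xs = allFin (n G)} (∈-lookup a))

  induced-∈ : ∀ {𝒢} → Monotone 𝒢 → 𝒢 G → 𝒢 induced
  induced-∈ monotone = monotone G induced (embed , embed-injective , id)

  induced-lifts : ∀ {x y} → Adj G x y → P x → P y → Lifts induced G embed x y
  induced-lifts {x} {y} xy px py =
    Any.index x∈ , Any.index y∈ , subst₂ (Adj G) (lookup-index x∈) (lookup-index y∈) xy ,
    sym (lookup-index x∈) , sym (lookup-index y∈)
    where
    x∈ = ∈-filter⁺ P? (∈-allFin x) px
    y∈ = ∈-filter⁺ P? (∈-allFin y) py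

Σ-Fin-suc↔ : ∀ {k} (B : Fin (suc k) → Set) → Σ (Fin (suc k)) B ↔ (B zero ⊎ Σ (Fin k) (B ∘ suc))
Σ-Fin-suc↔ B = mk↔ₛ′ split merge split∘merge merge∘split
  where
  split : Σ _ B → B zero ⊎ Σ _ (B ∘ suc)
  split (zero  , x) = inj₁ x
  split (suc j , x) = inj₂ (j , x)
  merge : B zero ⊎ Σ _ (B ∘ suc) → Σ _ B
  merge (inj₁ x)       = zero , x
  merge (inj₂ (j , x)) = suc j , x
  split∘merge : ∀ y → split (merge y) ≡ y
  split∘merge (inj₁ x)       = refl
  split∘merge (inj₂ (j , x)) = refl
  merge∘split : ∀ p → merge (split p) ≡ p
  merge∘split (zero  , x) = refl
  merge∘split (suc j , x) = refl

Fin-∑↔Σ : ∀ {k} (m : Fin k → ℕ) → Fin (foldr _+_ 0 m) ↔ Σ (Fin k) (Fin ∘ m)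
Fin-∑↔Σ {zero}  m = mk↔ₛ′ (λ ()) (λ { (() , _) }) (λ { (() , _) }) (λ ())
Fin-∑↔Σ {suc k} m = ↔-trans +↔⊎ (↔-trans (↔-refl ⊎-↔ Fin-∑↔Σ (m ∘ suc)) (↔-sym (Σ-Fin-suc↔ (Fin ∘ m))))

-- Bar's adjacency relation on Σ (Fin k) (V ∘ F) is local to its definition, so the type of the last
-- component of a Bar-witness can only be named by unifying Bar with nested Σ-types.
Σ-family : ∀ {a b} {A : Set a} {B : A → Set b} → Σ A B ≡ Σ A B → A → Set b
Σ-family {B = B} _ = B

BarEdges : (𝒢 : GraphClass) (K : Graph) {k : ℕ} (F : Fin k → Graph) →
  (∀ j → 𝒢 (F j)) → V K ↔ Σ (Fin k) (V ∘ F) → Set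
BarEdges 𝒢 K {k} F F∈ =
  Σ-family (refl {x = Σ-family (refl {x = Σ-family (refl {x = Σ-family (refl {x = Bar 𝒢 K}) k}) F}) F∈})

module DisjointUnion {k : ℕ} (F : Fin k → Graph) where

  private
    vertices↔ : Fin (foldr _+_ 0 (n ∘ F)) ↔ Σ (Fin k) (V ∘ F)
    vertices↔ = Fin-∑↔Σ (n ∘ F)
    open Inverse vertices↔ using (to; from; strictlyInverseˡ)

  AdjΣ : Σ (Fin k) (V ∘ F) → Σ (Fin k) (V ∘ F) → Set
  AdjΣ (i , x) (j , y) = Σ (i ≡ j) λ { refl → Adj (F i) x y }

  ⨁ : Graph
  ⨁ = record
    { n = foldr _+_ 0 (n ∘ F) ; Adj = λ u v → AdjΣ (to u) (to v)
    ; adj-sym = λ {u} {v} → AdjΣ-sym (to u) (to v) ; irrefl = λ {u} → AdjΣ-irrefl (to u) }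
    where
    AdjΣ-sym : ∀ p q → AdjΣ p q → AdjΣ q p
    AdjΣ-sym (i , x) (.i , y) (refl , xy) = refl , adj-sym (F i) xy
    AdjΣ-irrefl : ∀ p → AdjΣ p p → ⊥
    AdjΣ-irrefl (i , x) (refl , xx) = irrefl (F i) xx

  ι : ∀ j → V (F j) → V ⨁
  ι j x = from (j , x)

  ι-edge : ∀ {j x y} → Adj (F j) x y → Adj ⨁ (ι j x) (ι j y)
  ι-edge {j} {x} {y} xy =
    subst₂ AdjΣ (sym (strictlyInverseˡ (j , x))) (sym (strictlyInverseˡ (j , y))) (refl , xy)

  ⨁∈Bar : ∀ {𝒢} (F∈ : ∀ j → 𝒢 (F j)) → Bar 𝒢 ⨁
  ⨁∈Bar {𝒢} F∈ = k , F , F∈ , vertices↔ , edges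
    where
    edges : BarEdges 𝒢 ⨁ F F∈ vertices↔
    edges u v with to u | to v
    ... | i , x | j , y = (λ { (refl , xy) → refl , xy }) , (λ { (refl , xy) → refl , xy })

  module _ {H : Graph} (ψ : ∀ j → V (F j) → V H) where

    copair : V ⨁ → V H
    copair = uncurry ψ ∘ to

    copair-hom : (∀ j → IsHom (F j) H (ψ j)) → IsHom ⨁ H copair
    copair-hom ψ-hom {u} {v} = homΣ (to u) (to v)
      where
      homΣ : ∀ p q → AdjΣ p q → Adj H (uncurry ψ p) (uncurry ψ q)
      homΣ (i , x) (.i , y) (refl , xy) = ψ-hom i xy

    copair-injective : Injective _≡_ _≡_ (uncurry ψ) → Injective _≡_ _≡_ copair
    copair-injective ψ-injective = Injection.injective (↔⇒↣ vertices↔) ∘ ψ-injective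

    copair-lifts : ∀ {j x y} → Adj (F j) x y → Lifts ⨁ H copair (ψ j x) (ψ j y)
    copair-lifts {j} {x} {y} xy = ι j x , ι j y , ι-edge xy ,
      cong (uncurry ψ) (strictlyInverseˡ (j , x)) , cong (uncurry ψ) (strictlyInverseˡ (j , y))

module CoverVertices {𝒢 : GraphClass} {H : Graph} {t : ℕ} (C : Cover 𝒢 H t) where

  Vertex : Set
  Vertex = Σ (Fin t) (V ∘ G C)

  cover-map : Vertex → V H
  cover-map = uncurry (φ C)

  vertices : List Vertex
  vertices = concatMap (λ j → map (j ,_) (allFin (n (G C j)))) (allFin t)

  ∈-vertices : ∀ w → w ∈ vertices
  ∈-vertices (j , x) = ∈-concatMap⁺ (λ j → map (j ,_) (allFin (n (G C j))))
    (Any.map (λ { refl → ∈-map⁺ (j ,_) (∈-allFin x) }) (∈-allFin j))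

  open Fibres _≟_ cover-map ∈-vertices public

  ∣fibre∣≡preimageSize : ∀ v → length (fibre v) ≡ preimageSize C v
  ∣fibre∣≡preimageSize v = trans (length-filter-concatMap P? _ (allFin t))
    (cong sum (map-cong (λ j → length-filter-map P? (j ,_) (allFin (n (G C j)))) (allFin t)))
    where
    P? = λ w → cover-map w ≟ v

  label : ∀ {s} → Local s C → Vertex → Fin s
  label {s} local w = fromℕ< (<-≤-trans (rank<∣fibre∣ w)
    (subst (_≤ s) (sym (∣fibre∣≡preimageSize (cover-map w))) (local (cover-map w))))

  label-injective : ∀ {s} (local : Local s C) {w w'} → cover-map w ≡ cover-map w' →
    label local w ≡ label local w' → w ≡ w'
  label-injective local eq = rank-injective eq ∘ fromℕ<-injective _ _ _ _

module Construction {𝒢 : GraphClass} (monotone : Monotone 𝒢) {H : Graph} {t s : ℕ}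
                    (C : Cover 𝒢 H t) (local : Local s C)
                    (b L : ℕ) (c : V H → Fin (b ^ L)) (proper : ∀ {u v} → Adj H u v → c u ≢ c v) where

  open CoverVertices C

  digit : Fin L → Vertex → Fin b
  digit i w = finToFun (c (cover-map w)) i

  Selector : Set
  Selector = Fin L × Fin (s ^ b)

  Kept : Selector → Vertex → Set
  Kept (i , code) w = label local w ≡ finToFun code (digit i w)

  Kept? : ∀ σ j → Decidable (λ x → Kept σ (j , x))
  Kept? (i , code) j x = label local (j , x) ≟ finToFun code (digit i (j , x))

  piece : Selector → Fin t → Graph
  piece σ j = Induced.induced (G C j) (Kept? σ j)

  piece-embed : ∀ σ j → V (piece σ j) → V (G C j)
  piece-embed σ j = Induced.embed (G C j) (Kept? σ j)

  piece-kept : ∀ σ j a → Kept σ (j , piece-embed σ j a)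
  piece-kept σ j = Induced.embed-∈ (G C j) (Kept? σ j)

  piece-map : ∀ σ j → V (piece σ j) → V H
  piece-map σ j = φ C j ∘ piece-embed σ j

  component : Selector → Graph
  component σ = DisjointUnion.⨁ (piece σ)

  component-map : ∀ σ → V (component σ) → V H
  component-map σ = DisjointUnion.copair (piece σ) {H} (piece-map σ)

  component∈Bar : ∀ σ → Bar 𝒢 (component σ)
  component∈Bar σ = DisjointUnion.⨁∈Bar (piece σ) {𝒢} λ j →
    Induced.induced-∈ (G C j) (Kept? σ j) monotone (inCls C j)

  component-hom : ∀ σ → IsHom (component σ) H (component-map σ)
  component-hom σ = DisjointUnion.copair-hom (piece σ) {H} (piece-map σ) (λ j → hom C j)

  kept-injective : ∀ σ {w w'} → Kept σ w → Kept σ w' → cover-map w ≡ cover-map w' → w ≡ w'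
  kept-injective (i , code) {w} {w'} kw kw' eq = label-injective local eq (begin
    label local w               ≡⟨ kw ⟩
    finToFun code (digit i w)   ≡⟨ cong (λ v → finToFun code (finToFun (c v) i)) eq ⟩
    finToFun code (digit i w')  ≡⟨ kw' ⟨
    label local w'              ∎)
    where open ≡-Reasoning

  component-injective : ∀ σ → Injective _≡_ _≡_ (component-map σ)
  component-injective σ =
    DisjointUnion.copair-injective (piece σ) {H} (piece-map σ) λ {(j , a)} {(j' , a')} eq →
      map₂-injective (Induced.embed-injective (G C _) (Kept? σ _))
        (kept-injective σ (piece-kept σ j a) (piece-kept σ j' a') eq)

  component-lifts : ∀ σ {j x y} → Adj (G C j) x y → Kept σ (j , x) → Kept σ (j , y) →
    Lifts (component σ) H (component-map σ) (φ C j x) (φ C j y)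
  component-lifts σ {j} xy kx ky = extend (Induced.induced-lifts (G C j) (Kept? σ j) xy kx ky)
    where
    extend : ∀ {x y} → Lifts (piece σ j) (G C j) (piece-embed σ j) x y →
      Lifts (component σ) H (component-map σ) (φ C j x) (φ C j y)
    extend (a , a' , aa' , refl , refl) = DisjointUnion.copair-lifts (piece σ) {H} (piece-map σ) aa'

  selector : ∀ {j x y} → Adj (G C j) x y → ∃ λ σ → Kept σ (j , x) × Kept σ (j , y)
  selector {j} {x} {y} xy = separate (finToFun-separates {b} {L} (proper (hom C j xy)))
    where
    separate : (∃ λ i → digit i (j , x) ≢ digit i (j , y)) → ∃ λ σ → Kept σ (j , x) × Kept σ (j , y)
    separate (i , dx≢dy) =
      (i , funToFin ℓ) ,
      sym (trans (finToFun-funToFin ℓ dx) (updateAt-updates dx (const (label local (j , y))))) ,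
      sym (trans (finToFun-funToFin ℓ dy) (updateAt-minimal dy dx (const (label local (j , y))) (dx≢dy ∘ sym)))
      where
      dx = digit i (j , x)
      dy = digit i (j , y)
      ℓ : Fin b → Fin s
      ℓ = updateAt (const (label local (j , y))) dx (const (label local (j , x)))

  component-at : Fin (L * s ^ b) → Selector
  component-at = remQuot (s ^ b)

  lifts : ∀ {u v} → (Σ (Fin t) λ j → Lifts (G C j) H (φ C j) u v) →
    Σ (Fin (L * s ^ b)) λ k → Lifts (component (component-at k)) H (component-map (component-at k)) u v
  lifts (j , x , y , xy , refl , refl) =
    let ((i , code) , kx , ky) = selector xy
    in combine i code ,
       subst (λ σ → Lifts (component σ) H (component-map σ) _ _) (sym (remQuot-combine i code))
         (component-lifts (i , code) xy kx ky)

  injective-cover : HasUCover 𝒢 H (L * s ^ b)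
  injective-cover = record
    { G = component ∘ component-at ; inCls = component∈Bar ∘ component-at
    ; φ = component-map ∘ component-at ; hom = λ k → component-hom (component-at k)
    ; surj = lifts ∘ surj C }
    , λ k → component-injective (component-at k)

HasFCover⇒HasUCover : ∀ {𝒢} → Monotone 𝒢 → ∀ {H s} b L →
  HasFCover 𝒢 H s → Colorable H (b ^ L) → HasUCover 𝒢 H (L * s ^ b)
HasFCover⇒HasUCover monotone b L (_ , C , local) (c , proper) =
  Construction.injective-cover monotone C local b L c proper

proposition18 : (𝒢 : GraphClass) → Monotone 𝒢 → 𝒢 K₂ →
    (H : Graph) (χ cu cf : ℕ) → IsChi H χ → IsCu 𝒢 H cu → IsCf 𝒢 H cf →
    cu ≤ ⌈log₂ χ ⌉ * (cf ^ 2)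
-- K₂ ∈ 𝒢 only guarantees that c_f is defined, which the hypothesis on cf already provides.
proposition18 _ monotone _ H χ _ _ (lift χ-colouring , _) (_ , cu-least) (f-cover , _) =
  cu-least _ (HasFCover⇒HasUCover monotone 2 ⌈log₂ χ ⌉ f-cover
    (Colorable-≤ {H} (n≤2^⌈log₂n⌉ χ) χ-colouring))
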